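{- Let $G$ be any graph. For every flower subgraph $G'$ of $G$, $|\mathcal{P}(G)| \ge |\mathcal{P}(G')|$, where $\mathcal{P}(H)$ denotes the family of petal mp-subgraphs of a graph $H$.
   Context: All graphs are finite, simple and undirected. A clique separator of a connected graph is a clique whose removal disconnects it; a connected graph is prime if it has no clique separator. An mp-subgraph of $G$ is a maximal induced subgraph of $G$ that is prime. For an mp-subgraph $M$, $\partial M$ is the set of vertices of $M$ belonging to some other mp-subgraph of $G$, and $M^\circ = V(M) - \partial M$. $M$ is a petal mp-subgraph if $M^\circ \ne \varnothing$ and $\partial M$ is a clique (possibly empty). Flower subgraphs: $G$ is a flower subgraph of $G$; if $G'$ is a flower subgraph of $G$ and $M$ a petal mp-subgraph of $G'$, then $G' - M^\circ$ is a flower subgraph of $G$. -}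

module Defs where

open import Data.Nat using (ℕ)
open import Data.Bool using (Bool; true; false)
open import Data.Fin using (Fin)
open import Data.Fin.Subset using (Subset; _∈_; _∉_; _⊆_; _─_; ⊤)
open import Data.Product using (Σ; ∃; _×_; _,_)
open import Data.Empty using (⊥)
open import Data.List using (List; length)
open import Data.List.Relation.Unary.Unique.Propositional using (Unique)
import Data.List.Membership.Propositional as LM
open import Relation.Nullary using (¬_)
open import Relation.Binary.PropositionalEquality using (_≡_; _≢_)
open import Function.Bundles using (_⇔_)

record Graph (n : ℕ) : Set where
  field
    adj    : Fin n → Fin n → Bool
    sym    : ∀ u v → adj u v ≡ adj v u
    irrefl : ∀ v → adj v v ≡ false
open Graph public

-- Induced subgraphs of G are identified with their vertex sets (Subset n).
module _ {n : ℕ} (G : Graph n) where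

  data Reach (T : Subset n) (u : Fin n) : Fin n → Set where
    here : u ∈ T → Reach T u u
    step : ∀ {v w} → Reach T u v → w ∈ T → adj G v w ≡ true → Reach T u w

  -- G[T] is connected (connected graphs are nonempty).
  Connected : Subset n → Set
  Connected T = (∃ λ u → u ∈ T) × (∀ u v → u ∈ T → v ∈ T → Reach T u v)

  Disconnected : Subset n → Set
  Disconnected T = ∃ λ u → ∃ λ v → u ∈ T × v ∈ T × ¬ Reach T u v

  IsClique : (Fin n → Set) → Set
  IsClique C = ∀ u v → C u → C v → u ≢ v → adj G u v ≡ true

  CliqueSeparator : Subset n → Subset n → Set
  CliqueSeparator S C = C ⊆ S × IsClique (_∈ C) × Disconnected (S ─ C)

  Prime : Subset n → Set
  Prime S = Connected S × (∀ C → ¬ CliqueSeparator S C)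

  MP : Subset n → Subset n → Set
  MP S M = M ⊆ S × Prime M × (∀ M' → M ⊆ M' → M' ⊆ S → Prime M' → M' ⊆ M)

  Boundary : Subset n → Subset n → Fin n → Set
  Boundary S M v = v ∈ M × (∃ λ M' → MP S M' × M' ≢ M × v ∈ M')

  Interior : Subset n → Subset n → Fin n → Set
  Interior S M v = v ∈ M × ¬ Boundary S M v

  Petal : Subset n → Subset n → Set
  Petal S M = MP S M × (∃ λ v → Interior S M v) × IsClique (Boundary S M)

  data Flower : Subset n → Set where
    whole  : Flower ⊤
    remove : ∀ {S M} → Flower S → Petal S M →
             (S' : Subset n) → (∀ v → v ∈ S' ⇔ (v ∈ S × ¬ Interior S M v)) →
             Flower S'

HasSize : {n : ℕ} → (Subset n → Set) → ℕ → Set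
HasSize {n} P k = Σ (List (Subset n)) λ L →
  Unique L × (∀ M → (M LM.∈ L) ⇔ P M) × length L ≡ k

-- Removing the interior of a petal M from H = G[S] leaves H' = G[S − M°] whose
-- petals inject into the petals of H. Every petal A of H' is an mp-subgraph of H,
-- and A fails to be a petal of H only if some vertex of ∂M lies in A°; since ∂M is
-- a clique, any two such vertices lie in a common mp-subgraph of H', so at most one
-- petal of H' is exceptional, and it can be traded for M, which is not in H'.
-- Primality and maximality are not decided, so the argument runs in the
-- double-negation monad; this suffices because the inequality of sizes is decidable.
module Submission where

open import Defs hiding (sym)
open import Level using (0ℓ)
open import Data.Nat using (ℕ; _≤_; _≤?_; suc; s≤s; z≤n)
open import Data.Nat.Properties using (≤-refl; ≤-trans)
open import Data.Bool using (true) renaming (_≟_ to _≟ᵇ_)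
open import Data.Fin using (Fin) renaming (_≟_ to _≟ᶠ_)
open import Data.Fin.Subset
  using (Subset; ⊤; _∈_; _∉_; _⊆_; _⊈_; _⊂_; _⊃_; _∪_; ⁅_⁆; Nonempty)
open import Data.Fin.Subset.Properties
  using (_∈?_; ⊆-refl; ⊆-trans; x∈p∪q⁺; x∈p∪q⁻; x∈⁅x⁆; x∈⁅y⁆⇒x≡y; p─q⊆p)
open import Data.Fin.Subset.Induction using (Acc; acc; ⊃-wellFounded)
open import Data.Vec.Properties using (≡-dec)
open import Data.Product using (∃; _×_; _,_; proj₁; proj₂)
open import Data.Sum using (inj₁; inj₂; [_,_])
open import Data.List using (List; _∷_; length; filter)
open import Data.List.Properties using (filter-notAll)
open import Data.List.Relation.Unary.All as All using (All; _∷_)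
open import Data.List.Relation.Unary.Any as Any using (Any; here; there)
open import Data.List.Relation.Unary.All.Properties using (¬Any⇒All¬)
open import Data.List.Relation.Unary.AllPairs using (_∷_)
open import Data.List.Relation.Unary.Unique.Propositional using (Unique)
import Data.List.Relation.Unary.Unique.Propositional.Properties as Unique
import Data.List.Membership.Propositional as List
open import Data.List.Membership.Propositional.Properties using (∈-filter⁺; ∈-filter⁻)
open import Effect.Monad using (RawMonad)
open import Function using (_∘_; id)
open import Function.Bundles using (Equivalence; _⇔_)
open import Relation.Binary.Definitions using (DecidableEquality)
open import Relation.Binary.PropositionalEquality using (_≡_; _≢_; refl; sym; trans; subst)
open import Relation.Nullary using (¬_; yes; no; ¬?)
open import Relation.Nullary.Decidable using (decidable-stable; ¬¬-excluded-middle)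
open import Relation.Nullary.Negation using (DoubleNegation; ¬¬-Monad)

open RawMonad {0ℓ} ¬¬-Monad
open Equivalence

module _ {A : Set} (_≟_ : DecidableEquality A) where

  without : A → List A → List A
  without e = filter (λ x → ¬? (x ≟ e))

  ∈⇒∈∷without : ∀ e {x xs} → x List.∈ xs → x List.∈ e ∷ without e xs
  ∈⇒∈∷without e {x} x∈xs with x ≟ e
  ... | yes x≡e = here x≡e
  ... | no x≢e  = there (∈-filter⁺ _ x∈xs x≢e)

  Unique-⊆⇒length≤ : ∀ {xs ys : List A} → Unique xs → (∀ {x} → x List.∈ xs → x List.∈ ys) →
                     length xs ≤ length ys
  Unique-⊆⇒length≤ {List.[]} _ _ = z≤n
  Unique-⊆⇒length≤ {x ∷ xs} {ys} (x∉xs ∷ uniq) xs⊆ys =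
    ≤-trans (s≤s (Unique-⊆⇒length≤ uniq xs⊆ys-x)) (filter-notAll (λ y → ¬? (y ≟ x)) ys x∈ys)
    where
    xs⊆ys-x : ∀ {y} → y List.∈ xs → y List.∈ without x ys
    xs⊆ys-x y∈xs = ∈-filter⁺ _ (xs⊆ys (there y∈xs)) (λ y≡x → All.lookup x∉xs y∈xs (sym y≡x))
    x∈ys : Any (λ y → ¬ y ≢ x) ys
    x∈ys = Any.map (λ x≡y y≢x → y≢x (sym x≡y)) (xs⊆ys (here refl))

-- P ≼ Q: classically, P has at most as many elements as Q.
_≼_ : {A : Set} → (A → Set) → (A → Set) → Set
P ≼ Q = ∀ {xs} → Unique xs → All P xs →
        DoubleNegation (∃ λ ys → Unique ys × All Q ys × length xs ≤ length ys)

module _ {A : Set} where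

  ≼-refl : {P : A → Set} → P ≼ P
  ≼-refl uniq Pxs = pure (_ , uniq , Pxs , ≤-refl)

  ≼-trans : {P Q R : A → Set} → P ≼ Q → Q ≼ R → P ≼ R
  ≼-trans P≼Q Q≼R uniq Pxs = do
    (ys , uniq-ys , Qys , xs≤ys) ← P≼Q uniq Pxs
    (zs , uniq-zs , Rzs , ys≤zs) ← Q≼R uniq-ys Qys
    pure (zs , uniq-zs , Rzs , ≤-trans xs≤ys ys≤zs)

  ≼-by-exchange : {P Q : A → Set} → DecidableEquality A → ∀ m → Q m → ¬ P m →
                  (∀ {x e} → P x → P e → ¬ Q e → x ≢ e → DoubleNegation (Q x)) → P ≼ Q
  ≼-by-exchange {P} {Q} _≟_ m Qm ¬Pm at-most-one {xs} uniq Pxs = do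
    yes some-¬Q ← ¬¬-excluded-middle {A = Any (¬_ ∘ Q) xs}
      where no no-¬Q → do
              Qxs ← All.mapM 0ℓ ¬¬-Monad id (¬Any⇒All¬ xs no-¬Q)
              pure (xs , uniq , Qxs , ≤-refl)
    let (e , e∈xs , ¬Qe) = List.find some-¬Q
        others = without _≟_ e xs
        P-others : All P others
        P-others = All.tabulate (λ x∈ → All.lookup Pxs (proj₁ (∈-filter⁻ _ x∈)))
    Q-others ← All.mapM 0ℓ ¬¬-Monad id (All.tabulate λ x∈ →
      let (x∈xs , x≢e) = ∈-filter⁻ _ x∈ in
      at-most-one (All.lookup Pxs x∈xs) (All.lookup Pxs e∈xs) ¬Qe x≢e)
    pure ( m ∷ others
         , All.map (λ {x} Px m≡x → ¬Pm (subst P (sym m≡x) Px)) P-others ∷ Unique.filter⁺ _ uniq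
         , Qm ∷ Q-others
         , Unique-⊆⇒length≤ _≟_ uniq (∈⇒∈∷without _≟_ e))

_≟ₛ_ : ∀ {n} → DecidableEquality (Subset n)
_≟ₛ_ = ≡-dec _≟ᵇ_

≼⇒size≤ : ∀ {n} {P Q : Subset n → Set} {k l} → P ≼ Q → HasSize P k → HasSize Q l → k ≤ l
≼⇒size≤ P≼Q (xs , uniq-xs , ∈xs⇔ , refl) (zs , _ , ∈zs⇔ , refl) =
  decidable-stable (_ ≤? _) do
    (ys , uniq-ys , Qys , xs≤ys) ← P≼Q uniq-xs (All.tabulate (to (∈xs⇔ _)))
    pure (≤-trans xs≤ys (Unique-⊆⇒length≤ _≟ₛ_ uniq-ys (from (∈zs⇔ _) ∘ All.lookup Qys)))

⊈⇒¬¬∃∉ : ∀ {n} {p q : Subset n} → p ⊈ q → DoubleNegation (∃ λ x → x ∈ p × x ∉ q)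
⊈⇒¬¬∃∉ {q = q} p⊈q ∄ = p⊈q λ {x} x∈p → decidable-stable (x ∈? q) (λ x∉q → ∄ (x , x∈p , x∉q))

module _ {n : ℕ} (G : Graph n) where

  clique-prime : ∀ {X} → IsClique G (_∈ X) → Nonempty X → Prime G X
  clique-prime {X} clique nonempty = (nonempty , λ u v → reach u v id) , no-separator
    where
    reach : ∀ {Y} u v → Y ⊆ X → u ∈ Y → v ∈ Y → Reach G Y u v
    reach u v Y⊆X u∈Y v∈Y with u ≟ᶠ v
    ... | yes refl = here u∈Y
    ... | no u≢v   = step (here u∈Y) v∈Y (clique u v (Y⊆X u∈Y) (Y⊆X v∈Y) u≢v)
    no-separator : ∀ C → ¬ CliqueSeparator G X C
    no-separator C (_ , _ , u , v , u∈ , v∈ , ¬reach) = ¬reach (reach u v (p─q⊆p X C) u∈ v∈)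

  ProperPrimeExtension : Subset n → Subset n → Set
  ProperPrimeExtension T X = ∃ λ Q → X ⊂ Q × Q ⊆ T × Prime G Q

  mp-if-unextendable : ∀ {T X} → X ⊆ T → Prime G X → ¬ ProperPrimeExtension T X → MP G T X
  mp-if-unextendable {X = X} X⊆T prime unextendable =
    X⊆T , prime , λ Q X⊆Q Q⊆T primeQ {x} x∈Q →
      decidable-stable (x ∈? X) (λ x∉X → unextendable (Q , (X⊆Q , x , x∈Q , x∉X) , Q⊆T , primeQ))

  ¬mp⇒¬¬extension : ∀ {T X} → X ⊆ T → Prime G X → ¬ MP G T X →
                     DoubleNegation (ProperPrimeExtension T X)
  ¬mp⇒¬¬extension X⊆T prime ¬mp unextendable = ¬mp (mp-if-unextendable X⊆T prime unextendable)

  InMP : Subset n → Subset n → Set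
  InMP T X = ∃ λ B → MP G T B × X ⊆ B

  prime⊆mp : ∀ {T X} → X ⊆ T → Prime G X → DoubleNegation (InMP T X)
  prime⊆mp {T} = go (⊃-wellFounded _)
    where
    go : ∀ {X} → Acc _⊃_ X → X ⊆ T → Prime G X → DoubleNegation (InMP T X)
    go {X} (acc larger) X⊆T prime = do
      yes (Q , X⊂Q , Q⊆T , primeQ) ← ¬¬-excluded-middle {A = ProperPrimeExtension T X}
        where no unextendable →
                pure {A = InMP T X} (X , mp-if-unextendable X⊆T prime unextendable , ⊆-refl)
      (B , mpB , Q⊆B) ← go (larger X⊂Q) Q⊆T primeQ
      pure {A = InMP T X} (B , mpB , ⊆-trans (proj₁ X⊂Q) Q⊆B)

  clique-pair⊆mp : ∀ {T u v} {C : Fin n → Set} → IsClique G C → (∀ {x} → C x → x ∈ T) →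
                   C u → C v → DoubleNegation (∃ λ B → MP G T B × u ∈ B × v ∈ B)
  clique-pair⊆mp {T} {u} {v} {C} clique C⊆T Cu Cv = do
      (B , mpB , uv⊆B) ← prime⊆mp (λ x∈ → C⊆T (C∋ x∈)) (clique-prime uv-clique (u , u∈uv))
      pure (B , mpB , uv⊆B u∈uv , uv⊆B v∈uv)
    where
    uv : Subset n
    uv = ⁅ u ⁆ ∪ ⁅ v ⁆
    u∈uv : u ∈ uv
    u∈uv = x∈p∪q⁺ (inj₁ (x∈⁅x⁆ u))
    v∈uv : v ∈ uv
    v∈uv = x∈p∪q⁺ (inj₂ (x∈⁅x⁆ v))
    C∋ : ∀ {x} → x ∈ uv → C x
    C∋ {x} x∈uv = [ (λ x∈u → subst C (sym (x∈⁅y⁆⇒x≡y u x∈u)) Cu)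
                  , (λ x∈v → subst C (sym (x∈⁅y⁆⇒x≡y v x∈v)) Cv) ] (x∈p∪q⁻ ⁅ u ⁆ ⁅ v ⁆ x∈uv)
    uv-clique : IsClique G (_∈ uv)
    uv-clique x y x∈ y∈ = clique x y (C∋ x∈) (C∋ y∈)

  clique-¬¬⊆ : ∀ {C D : Fin n → Set} → IsClique G C → (∀ {v} → D v → DoubleNegation (C v)) →
               IsClique G D
  clique-¬¬⊆ clique D⊆C u v Du Dv u≢v = decidable-stable (adj G u v ≟ᵇ true) λ ¬adj →
    D⊆C Du λ Cu → D⊆C Dv λ Cv → ¬adj (clique u v Cu Cv u≢v)

  mp-restrict : ∀ {S S' A} → S' ⊆ S → A ⊆ S' → MP G S A → MP G S' A
  mp-restrict S'⊆S A⊆S' (_ , prime , maximal) =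
    A⊆S' , prime , λ Q A⊆Q Q⊆S' → maximal Q A⊆Q (⊆-trans Q⊆S' S'⊆S)

  mp∋interior⇒≡ : ∀ {S M B v} → MP G S B → Interior G S M v → v ∈ B → B ≡ M
  mp∋interior⇒≡ {M = M} {B} mpB (v∈M , v∉∂M) v∈B =
    decidable-stable (B ≟ₛ M) λ B≢M → v∉∂M (v∈M , B , mpB , B≢M , v∈B)

  module PetalRemoval {S M S'} (petalM : Petal G S M)
                      (S'-def : ∀ v → v ∈ S' ⇔ (v ∈ S × ¬ Interior G S M v)) where

    S'⊆S : S' ⊆ S
    S'⊆S {v} v∈S' = proj₁ (to (S'-def v) v∈S')

    ∉S'⇒interior : ∀ {v} → v ∈ S → v ∉ S' → Interior G S M v
    ∉S'⇒interior {v} v∈S v∉S' =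
      decidable-stable (v ∈? M) (λ v∉M → v∉S' (from (S'-def v) (v∈S , v∉M ∘ proj₁))) ,
      λ ∂v → v∉S' (from (S'-def v) (v∈S , λ v° → proj₂ v° ∂v))

    S'∩M⊆∂M : ∀ {v} → v ∈ S' → v ∈ M → DoubleNegation (Boundary G S M v)
    S'∩M⊆∂M {v} v∈S' v∈M v∉∂M = proj₂ (to (S'-def v) v∈S') (v∈M , v∉∂M)

    ∂M⊆S' : ∀ {v} → Boundary G S M v → v ∈ S'
    ∂M⊆S' {v} ∂v = from (S'-def v) (proj₁ (proj₁ petalM) (proj₁ ∂v) , λ v° → proj₂ v° ∂v)

    M⊈S' : M ⊈ S'
    M⊈S' M⊆S' with proj₁ (proj₂ petalM)
    ... | v , v° = proj₂ (to (S'-def v) (M⊆S' (proj₁ v°))) v°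

    M-not-petal' : ¬ Petal G S' M
    M-not-petal' petal'M = M⊈S' (proj₁ (proj₁ petal'M))

    ⊆S'⇒≢M : ∀ {A} → A ⊆ S' → A ≢ M
    ⊆S'⇒≢M A⊆S' refl = M⊈S' A⊆S'

    other-mp⇒mp' : ∀ {A} → MP G S A → A ≢ M → MP G S' A
    other-mp⇒mp' {A} mpA A≢M = mp-restrict S'⊆S A⊆S' mpA
      where
      A⊆S' : A ⊆ S'
      A⊆S' {v} v∈A = from (S'-def v) (proj₁ mpA v∈A , λ v° → proj₂ v° (proj₁ v° , A , mpA , A≢M , v∈A))

    mp'∖mp⊆M : ∀ {X} → MP G S' X → ¬ MP G S X → DoubleNegation (X ⊆ M)
    mp'∖mp⊆M {X} (X⊆S' , primeX , maximalX) ¬mpX = do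
      (Q , (X⊆Q , x , x∈Q , x∉X) , Q⊆S , primeQ) ← ¬mp⇒¬¬extension (⊆-trans X⊆S' S'⊆S) primeX ¬mpX
      -- Q leaves S' through a vertex w of M°, and the mp-subgraph of G[S] around Q meets M°, so it is M.
      (w , w∈Q , w∉S') ← ⊈⇒¬¬∃∉ λ Q⊆S' → x∉X (maximalX Q X⊆Q Q⊆S' primeQ x∈Q)
      (B , mpB , Q⊆B) ← prime⊆mp Q⊆S primeQ
      let w° = ∉S'⇒interior (Q⊆S w∈Q) w∉S'
      pure {A = X ⊆ M} (subst (X ⊆_) (mp∋interior⇒≡ mpB w° (Q⊆B w∈Q)) (⊆-trans X⊆Q Q⊆B))

    petal'⇒mp : ∀ {A} → Petal G S' A → DoubleNegation (MP G S A)
    -- An interior vertex v of A in G[S'] would otherwise lie on ∂M, so in an mp-subgraph A' ≠ M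
    -- of G[S]; A' survives in G[S'] and meets A°, hence A' = A.
    petal'⇒mp {A} (mpA , (v , v°) , _) ¬mpA = mp'∖mp⊆M mpA ¬mpA λ A⊆M →
      S'∩M⊆∂M (proj₁ mpA (proj₁ v°)) (A⊆M (proj₁ v°)) λ (_ , A' , mpA' , A'≢M , v∈A') →
        ¬mpA (subst (MP G S) (mp∋interior⇒≡ (other-mp⇒mp' mpA' A'≢M) v° v∈A') mpA')

    Exceptional : Subset n → Set
    Exceptional A = ∃ λ v → Boundary G S M v × Interior G S' A v

    ∂-unexceptional : ∀ {A} → MP G S A → A ⊆ S' → ¬ Exceptional A →
                      ∀ {v} → Boundary G S A v → DoubleNegation (Boundary G S' A v)
    ∂-unexceptional {A} mpA A⊆S' unexceptional (v∈A , A'' , mpA'' , A''≢A , v∈A'') v∉∂'A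
      with A'' ≟ₛ M
    ... | yes refl = unexceptional (_ , (v∈A'' , A , mpA , ⊆S'⇒≢M A⊆S' , v∈A) , v∈A , v∉∂'A)
    ... | no A''≢M = v∉∂'A (v∈A , A'' , other-mp⇒mp' mpA'' A''≢M , A''≢A , v∈A'')

    petal'-unexceptional⇒petal : ∀ {A} → Petal G S' A → ¬ Exceptional A →
                                 DoubleNegation (Petal G S A)
    petal'-unexceptional⇒petal petalA@(mpA' , (v , v∈A , v∉∂'A) , ∂'A-clique) unexceptional = do
      mpA ← petal'⇒mp petalA
      let ∂A⊆∂'A = ∂-unexceptional mpA (proj₁ mpA') unexceptional
      pure (mpA , (v , v∈A , λ ∂v → ∂A⊆∂'A ∂v v∉∂'A) , clique-¬¬⊆ ∂'A-clique ∂A⊆∂'A)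

    exceptional-unique : ∀ {A₁ A₂} → Exceptional A₁ → Exceptional A₂ → A₁ ≡ A₂
    exceptional-unique {A₁} {A₂} (v₁ , ∂v₁ , v₁°) (v₂ , ∂v₂ , v₂°) =
      decidable-stable (A₁ ≟ₛ A₂) do
        (B , mpB , v₁∈B , v₂∈B) ← clique-pair⊆mp (proj₂ (proj₂ petalM)) ∂M⊆S' ∂v₁ ∂v₂
        pure (trans (sym (mp∋interior⇒≡ mpB v₁° v₁∈B)) (mp∋interior⇒≡ mpB v₂° v₂∈B))

    petal'≼petal : Petal G S' ≼ Petal G S
    petal'≼petal = ≼-by-exchange _≟ₛ_ M petalM M-not-petal'
      λ petalA petalE ¬petalE A≢E ¬petalA →
        petal'-unexceptional⇒petal petalA
          (λ excA → petal'-unexceptional⇒petal petalE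
            (λ excE → A≢E (exceptional-unique excA excE)) ¬petalE)
          ¬petalA

  flower≼whole : ∀ {S} → Flower G S → Petal G S ≼ Petal G ⊤
  flower≼whole whole = ≼-refl
  flower≼whole (remove flower petalM _ S'-def) =
    ≼-trans (PetalRemoval.petal'≼petal petalM S'-def) (flower≼whole flower)

lemma4 : ∀ {n : ℕ} (G : Graph n) (S : Subset n) → Flower G S →
           ∀ (k k' : ℕ) → HasSize (Petal G ⊤) k → HasSize (Petal G S) k' →
           k' ≤ k
lemma4 G S flower _ _ all-petals flower-petals =
  ≼⇒size≤ (flower≼whole G flower) flower-petals all-petals
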